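{- Let $\mathfrak G=(X,1,\curlywedge,s,A)$ and $\mathfrak G'=(X',1',\curlywedge',s',A')$ be general selection L-frames with admissible valuations $V,V'$, and let $f$ be a selection model morphism from $\mathfrak M=(\mathfrak G,V)$ to $\mathfrak M'=(\mathfrak G',V')$. Then for all $x\in X$ and every formula $\phi$: $\mathfrak M,x\Vdash\phi$ if and only if $\mathfrak M',f(x)\Vdash\phi$.
   Context: Formulas: $\phi::=p\mid\top\mid\bot\mid\phi\wedge\phi\mid\phi\vee\phi\mid\phi\Rightarrow\phi$. Meet-semilattice $(X,1,\curlywedge)$, $x\preccurlyeq y$ iff $x\curlywedge y=x$; filters are upward closed subsets closed under finite meets; $\mathcal F(X)$ the filters; $p\sqcup q:={\uparrow}\{x\curlywedge y:x\in p,y\in q\}$. A general selection L-frame is $(X,1,\curlywedge,s,A)$ where $A\subseteq\mathcal F(X)$ contains $X,\{1\}$ and is closed under $\cap$, $\sqcup$ and $a\Rightarrow b:=\{x: s(x,a)\subseteq b\}$, and $s:X\times A\to\mathcal F(X)$ satisfies for all $a\in A$: $s(1,a)=\{1\}$; $x\preccurlyeq y\Rightarrow s(y,a)\subseteq s(x,a)$; if $z\in s(x\curlywedge y,a)$ there are $u\in s(x,a)$, $v\in s(y,a)$ with $u\curlywedge v\preccurlyeq z$. An admissible valuation maps letters into $A$. Truth: $x\Vdash p$ iff $x\in V(p)$; $\top$ always; $x\Vdash\bot$ iff $x=1$; $\wedge$ pointwise; $x\Vdash\phi\vee\psi$ iff there are $y\Vdash\phi$, $z\Vdash\psi$ with $y\curlywedge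 z\preccurlyeq x$; $x\Vdash\phi\Rightarrow\psi$ iff $s(x,[\![\phi]\!])\subseteq[\![\psi]\!]$. An L-morphism is a semilattice homomorphism $f:X\to X'$ with $f(x)=1'$ iff $x=1$, and such that if $y'\curlywedge' z'\preccurlyeq' f(x)$ there are $y,z\in X$ with $y'\preccurlyeq' f(y)$, $z'\preccurlyeq' f(z)$, $y\curlywedge z\preccurlyeq x$. A selection morphism $\mathfrak G\to\mathfrak G'$ is an L-morphism $f$ such that for all $x\in X$, $a'\in A'$: $f^{ -1}(a')\in A$; if $y\in s(x,f^{ -1}(a'))$ then $f(y)\in s'(f(x),a')$; if $y'\in s'(f(x),a')$ there is $y\in s(x,f^{ -1}(a'))$ with $f(y)\preccurlyeq' y'$. A selection model morphism $(\mathfrak G,V)\to(\mathfrak G',V')$ is a selection morphism with $V(p)=f^{ -1}(V'(p))$ for all letters $p$. -}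

module Defs where

open import Level using (Level; 0ℓ)
open import Data.Nat using (ℕ)
open import Data.Unit using (⊤)
open import Data.Product using (Σ; ∃; ∃-syntax; _×_; _,_)
open import Relation.Binary.PropositionalEquality using (_≡_)
open import Function.Bundles using (_⇔_)

data Formula : Set where
  var  : ℕ → Formula
  ⊤f   : Formula
  ⊥f   : Formula
  _∧f_ : Formula → Formula → Formula
  _∨f_ : Formula → Formula → Formula
  _⇒f_ : Formula → Formula → Formula

Subset : Set → Set₁
Subset X = X → Set

_⊆_ : {X : Set} → Subset X → Subset X → Set
p ⊆ q = ∀ x → p x → q x

_≐_ : {X : Set} → Subset X → Subset X → Set
p ≐ q = (p ⊆ q) × (q ⊆ p)

module SL {X : Set} (one : X) (_⋏_ : X → X → X) where

  _≼_ : X → X → Set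
  x ≼ y = x ⋏ y ≡ x

  record IsFilter (p : Subset X) : Set where
    field
      up   : ∀ {x y} → x ≼ y → p x → p y
      one∈ : p one
      meet : ∀ {x y} → p x → p y → p (x ⋏ y)

  _⊔_ : Subset X → Subset X → Subset X
  (p ⊔ q) w = ∃[ x ] ∃[ y ] (p x × q y × ((x ⋏ y) ≼ w))

  _∩_ : Subset X → Subset X → Subset X
  (p ∩ q) w = p w × q w

-- The selection function s is given on all
-- subsets but all its conditions are only imposed for a ∈ A (only its
-- values on A matter); since subsets are predicates, A and s are required
-- to respect extensional equality of subsets (they act on sets).
record SelFrame : Set₂ where
  field
    X    : Set
    one  : X
    _⋏_  : X → X → X
    ⋏-assoc : ∀ x y z → (x ⋏ y) ⋏ z ≡ x ⋏ (y ⋏ z)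
    ⋏-comm  : ∀ x y → x ⋏ y ≡ y ⋏ x
    ⋏-idem  : ∀ x → x ⋏ x ≡ x
    ⋏-one   : ∀ x → x ⋏ one ≡ x

  open SL one _⋏_ public

  field
    A : Subset X → Set₁
    s : X → Subset X → Subset X

  _⇛_ : Subset X → Subset X → Subset X
  (a ⇛ b) x = s x a ⊆ b

  field
    A-ext    : ∀ {a b} → A a → a ≐ b → A b
    A-filter : ∀ {a} → A a → IsFilter a
    A-X      : A (λ _ → ⊤)
    A-one    : A (λ x → x ≡ one)
    A-∩      : ∀ {a b} → A a → A b → A (a ∩ b)
    A-⊔      : ∀ {a b} → A a → A b → A (a ⊔ b)
    A-⇛      : ∀ {a b} → A a → A b → A (a ⇛ b)

    s-ext    : ∀ {a b} x → A a → a ≐ b → s x a ≐ s x b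
    s-filter : ∀ {a} x → A a → IsFilter (s x a)
    s-one    : ∀ {a} → A a → s one a ≐ (λ y → y ≡ one)
    s-anti   : ∀ {a x y} → A a → x ≼ y → s y a ⊆ s x a
    s-meet   : ∀ {a x y z} → A a → s (x ⋏ y) a z →
               ∃[ u ] ∃[ v ] (s x a u × s y a v × ((u ⋏ v) ≼ z))

record Model : Set₂ where
  field
    frame : SelFrame
  open SelFrame frame public
  field
    V     : ℕ → Subset X
    V-adm : ∀ p → A (V p)

module _ (M : Model) where
  open Model M

  infix 4 _⊩_
  _⊩_ : X → Formula → Set
  x ⊩ var p   = V p x
  x ⊩ ⊤f      = ⊤
  x ⊩ ⊥f      = x ≡ one
  x ⊩ φ ∧f ψ  = (x ⊩ φ) × (x ⊩ ψ)
  x ⊩ φ ∨f ψ  = ∃[ y ] ∃[ z ] ((y ⊩ φ) × (z ⊩ ψ) × ((y ⋏ z) ≼ x))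
  x ⊩ φ ⇒f ψ  = ∀ y → s x (λ w → w ⊩ φ) y → y ⊩ ψ

_⁻¹[_] : {X Y : Set} → (X → Y) → Subset Y → Subset X
(f ⁻¹[ a ]) x = a (f x)

record IsSelModelMorphism (M M' : Model) (f : Model.X M → Model.X M') : Set₁ where
  module M  = Model M
  module M' = Model M'
  field
    hom-⋏   : ∀ x y → f (x M.⋏ y) ≡ f x M'.⋏ f y
    hom-one : ∀ x → (f x ≡ M'.one) ⇔ (x ≡ M.one)
    hom-∨   : ∀ x y' z' → (y' M'.⋏ z') M'.≼ f x →
              ∃[ y ] ∃[ z ] ((y' M'.≼ f y) × (z' M'.≼ f z) × ((y M.⋏ z) M.≼ x))
    pre-A   : ∀ {a'} → M'.A a' → M.A (f ⁻¹[ a' ])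
    sel-fwd : ∀ {a'} x y → M'.A a' → M.s x (f ⁻¹[ a' ]) y → M'.s (f x) a' (f y)
    sel-bwd : ∀ {a'} x y' → M'.A a' → M'.s (f x) a' y' →
              ∃[ y ] (M.s x (f ⁻¹[ a' ]) y × (f y M'.≼ y'))
    val     : ∀ p → M.V p ≐ (f ⁻¹[ M'.V p ])

-- Pulling a disjunction back along f
-- uses the L-morphism condition together with persistence of truth along ≼
-- (truth sets lie in A, hence are filters).  For implication, the induction
-- hypothesis makes the truth set of φ in M the preimage of its truth set in M′,
-- which is exactly the argument at which the selection-morphism conditions
-- relate s and s′.
module Submission where

open import Defs
open import Function.Bundles using (_⇔_; mk⇔; Equivalence)
open import Data.Product using (_,_; proj₁; proj₂)
open import Data.Unit using (tt)
open import Relation.Binary.PropositionalEquality using (cong; module ≡-Reasoning)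

open Equivalence using (to; from)

≐-sym : {X : Set} {a b : Subset X} → a ≐ b → b ≐ a
≐-sym (a⊆b , b⊆a) = b⊆a , a⊆b

truth-set : (M : Model) → Formula → Subset (Model.X M)
truth-set M φ w = _⊩_ M w φ

truth-set-admissible : (M : Model) (φ : Formula) → Model.A M (truth-set M φ)
truth-set-admissible M (var p)  = Model.V-adm M p
truth-set-admissible M ⊤f       = Model.A-X M
truth-set-admissible M ⊥f       = Model.A-one M
truth-set-admissible M (φ ∧f ψ) = Model.A-∩ M (truth-set-admissible M φ) (truth-set-admissible M ψ)
truth-set-admissible M (φ ∨f ψ) = Model.A-⊔ M (truth-set-admissible M φ) (truth-set-admissible M ψ)
truth-set-admissible M (φ ⇒f ψ) = Model.A-⇛ M (truth-set-admissible M φ) (truth-set-admissible M ψ)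

⊩-upward : (M : Model) (φ : Formula) {x y : Model.X M} →
           Model._≼_ M x y → _⊩_ M x φ → _⊩_ M y φ
⊩-upward M φ = IsFilter.up (A-filter (truth-set-admissible M φ))
  where open Model M

module _ {M M' : Model} {f : Model.X M → Model.X M'} (H : IsSelModelMorphism M M' f) where
  open IsSelModelMorphism H

  private
    _⊩₁_ : M.X → Formula → Set
    _⊩₁_ = _⊩_ M
    _⊩₂_ : M'.X → Formula → Set
    _⊩₂_ = _⊩_ M'
    ⟦_⟧₁ : Formula → Subset M.X
    ⟦_⟧₁ = truth-set M
    ⟦_⟧₂ : Formula → Subset M'.X
    ⟦_⟧₂ = truth-set M'

  Invariant : Formula → Set
  Invariant φ = ∀ x → (x ⊩₁ φ) ⇔ (f x ⊩₂ φ)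

  hom-mono : ∀ {x y} → x M.≼ y → f x M'.≼ f y
  hom-mono {x} {y} x≼y = begin
    f x M'.⋏ f y  ≡⟨ hom-⋏ x y ⟨
    f (x M.⋏ y)   ≡⟨ cong f x≼y ⟩
    f x           ∎
    where open ≡-Reasoning

  hom-meet-below : ∀ {y z x} → (y M.⋏ z) M.≼ x → (f y M'.⋏ f z) M'.≼ f x
  hom-meet-below {y} {z} {x} yz≼x = begin
    (f y M'.⋏ f z) M'.⋏ f x  ≡⟨ cong (M'._⋏ f x) (hom-⋏ y z) ⟨
    f (y M.⋏ z) M'.⋏ f x     ≡⟨ hom-mono yz≼x ⟩
    f (y M.⋏ z)              ≡⟨ hom-⋏ y z ⟩
    f y M'.⋏ f z             ∎
    where open ≡-Reasoning

  truth-set-preimage : ∀ φ → Invariant φ → ⟦ φ ⟧₁ ≐ (f ⁻¹[ ⟦ φ ⟧₂ ])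
  truth-set-preimage φ inv = (λ x → to (inv x)) , (λ x → from (inv x))

  var-invariant : ∀ p → Invariant (var p)
  var-invariant p x = mk⇔ (proj₁ (val p) x) (proj₂ (val p) x)

  ⊤-invariant : Invariant ⊤f
  ⊤-invariant x = mk⇔ (λ _ → tt) (λ _ → tt)

  ⊥-invariant : Invariant ⊥f
  ⊥-invariant x = mk⇔ (from (hom-one x)) (to (hom-one x))

  ∧-invariant : ∀ φ ψ → Invariant φ → Invariant ψ → Invariant (φ ∧f ψ)
  ∧-invariant φ ψ invφ invψ x = mk⇔
    (λ (xφ , xψ) → to (invφ x) xφ , to (invψ x) xψ)
    (λ (xφ , xψ) → from (invφ x) xφ , from (invψ x) xψ)

  ∨-invariant : ∀ φ ψ → Invariant φ → Invariant ψ → Invariant (φ ∨f ψ)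
  ∨-invariant φ ψ invφ invψ x = mk⇔ forward backward
    where
    forward : x ⊩₁ (φ ∨f ψ) → f x ⊩₂ (φ ∨f ψ)
    forward (y , z , yφ , zψ , yz≼x) =
      f y , f z , to (invφ y) yφ , to (invψ z) zψ , hom-meet-below yz≼x

    backward : f x ⊩₂ (φ ∨f ψ) → x ⊩₁ (φ ∨f ψ)
    backward (y' , z' , y'φ , z'ψ , y'z'≼fx) with hom-∨ x y' z' y'z'≼fx
    ... | y , z , y'≼fy , z'≼fz , yz≼x =
      y , z , from (invφ y) (⊩-upward M' φ y'≼fy y'φ)
            , from (invψ z) (⊩-upward M' ψ z'≼fz z'ψ) , yz≼x

  ⇒-invariant : ∀ φ ψ → Invariant φ → Invariant ψ → Invariant (φ ⇒f ψ)
  ⇒-invariant φ ψ invφ invψ x = mk⇔ forward backward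
    where
    A₂φ : M'.A ⟦ φ ⟧₂
    A₂φ = truth-set-admissible M' φ

    φ-preimage : ⟦ φ ⟧₁ ≐ (f ⁻¹[ ⟦ φ ⟧₂ ])
    φ-preimage = truth-set-preimage φ invφ

    s-from-preimage : M.s x (f ⁻¹[ ⟦ φ ⟧₂ ]) ⊆ M.s x ⟦ φ ⟧₁
    s-from-preimage = proj₁ (M.s-ext x (pre-A A₂φ) (≐-sym φ-preimage))

    s-to-preimage : M.s x ⟦ φ ⟧₁ ⊆ M.s x (f ⁻¹[ ⟦ φ ⟧₂ ])
    s-to-preimage = proj₁ (M.s-ext x (truth-set-admissible M φ) φ-preimage)

    forward : x ⊩₁ (φ ⇒f ψ) → f x ⊩₂ (φ ⇒f ψ)
    forward x⇒ y' y'∈s with sel-bwd x y' A₂φ y'∈s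
    ... | y , y∈s , fy≼y' =
      ⊩-upward M' ψ fy≼y' (to (invψ y) (x⇒ y (s-from-preimage y y∈s)))

    backward : f x ⊩₂ (φ ⇒f ψ) → x ⊩₁ (φ ⇒f ψ)
    backward fx⇒ y y∈s =
      from (invψ y) (fx⇒ (f y) (sel-fwd x y A₂φ (s-to-preimage y y∈s)))

  ⊩-invariant : ∀ φ → Invariant φ
  ⊩-invariant (var p)  = var-invariant p
  ⊩-invariant ⊤f       = ⊤-invariant
  ⊩-invariant ⊥f       = ⊥-invariant
  ⊩-invariant (φ ∧f ψ) = ∧-invariant φ ψ (⊩-invariant φ) (⊩-invariant ψ)
  ⊩-invariant (φ ∨f ψ) = ∨-invariant φ ψ (⊩-invariant φ) (⊩-invariant ψ)
  ⊩-invariant (φ ⇒f ψ) = ⇒-invariant φ ψ (⊩-invariant φ) (⊩-invariant ψ)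

theorem3p23 : (M M' : Model) (f : Model.X M → Model.X M') → IsSelModelMorphism M M' f → (x : Model.X M) (φ : Formula) → (_⊩_ M x φ) ⇔ (_⊩_ M' (f x) φ)
theorem3p23 M M' f H x φ = ⊩-invariant H φ x
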